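{- Let $p$ be a C-walk and let $\mathcal T(p)$ be the binary tree associated with $p$ by the recursive construction described in the context. Then: (1) the number of $\pm1$-steps of $p$ equals the number of double leaves of $\mathcal T(p)$; (2) the number of steps of $p$ that are odd $+2$-steps or even $-2$-steps equals the number of left leaves of $\mathcal T(p)$; (3) the number of steps of $p$ that are odd $-2$-steps or even $+2$-steps equals the number of right leaves of $\mathcal T(p)$.
   Context: Basketball walks are integer walks with steps in $\{ -2,-1,+1,+2\}$, viewed as step sequences started at height $0$ (the heights are then implicit); a step is even (resp. odd) if its starting height is even (resp. odd). For a step sequence $\mathfrak a=(a_1,\ldots,a_m)$, its reverse is $\bar{\mathfrak a}=(-a_m,\ldots,-a_1)$, and $\mathfrak a\mathfrak b$ denotes concatenation. An A-walk is a (possibly empty) nonnegative walk from $0$ to $0$. A B-walk is a walk from $0$ to $1$ that is positive except at its origin and visits $1$ only at its end (e.g. the one-step walk $(+1)$). A C-walk is a walk from $0$ to $0$ that visits $1$ and is positive except at its two extremities. Every C-walk $p\neq(+1,-1)$ can be written in exactly one way in exactly one of the following forms, where $\mathfrak b,\mathfrak b_1,\mathfrak b_2$ are B-walks, $\mathfrak a,\mathfrak a_1,\mathfrak a_2$ are A-walks and $\mathfrak c$ is a C-walk: (ii) $p=\mathfrak b_1\mathfrak c\mathfrak a\bar{\mathfrak b}_2$; (iii) $p=\mathfrak b_1\mathfrak b_2\mathfrak a(-2)$; (iv.1) $p=(+2)\mathfrak a\bar{\mathfrak b}(-1)$; (iv.2) $p=\mathfrak b_1(+2)\mathfrak a_1(-2)\mathfrak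 a_2\bar{\mathfrak b}_2$. Define $\Phi(p)=(\Phi_1(p),\Phi_2(p))$, with values in C-walks or a formal symbol $\varepsilon$, by: $\Phi((+1,-1))=(\varepsilon,\varepsilon)$; in case (ii) $\Phi(p)=(\bar{\mathfrak c},\mathfrak b_1\mathfrak a\bar{\mathfrak b}_2)$; in case (iii) $\Phi(p)=(\varepsilon,\mathfrak b_1\bar{\mathfrak a}\bar{\mathfrak b}_2)$; in case (iv.1) $\Phi(p)=(\mathfrak b\bar{\mathfrak a}(-1),\varepsilon)$; in case (iv.2) $\Phi(p)=(\mathfrak b_1\mathfrak a_1\mathfrak b_2\bar{\mathfrak a}_2(-2),\varepsilon)$. The tree $\mathcal T(p)$ is built as follows: start with a single vertex assigned the walk $p$; recursively, each vertex assigned a walk $q$ receives a left child and a right child; the left (resp. right) child is a leaf if $\Phi_1(q)=\varepsilon$ (resp. $\Phi_2(q)=\varepsilon$), and otherwise is assigned the walk $\Phi_1(q)$ (resp. $\Phi_2(q)$). This yields a binary tree (every internal vertex has a left and a right child) with as many leaves as $p$ has steps. In a binary tree, a double leaf is a leaf whose sibling is also a leaf; a left leaf (resp. right leaf) is a leaf which is a left (resp. right) child and whose sibling is not a leaf. -}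

module Defs where

open import Data.Bool using (Bool; true; false; _∧_; _∨_; not; if_then_else_)
open import Data.Nat as ℕ using (ℕ; zero; suc)
open import Data.Integer using (ℤ; +_; -_; _+_; ∣_∣; _≤?_; _<?_; _≟_)
open import Data.List using (List; []; _∷_; _++_; reverse; map)
open import Data.Maybe using (Maybe; just; nothing)
open import Relation.Nullary using (does)

data Step : Set where
  m2 m1 p1 p2 : Step

val : Step → ℤ
val m2 = - (+ 2)
val m1 = - (+ 1)
val p1 = + 1
val p2 = + 2

negStep : Step → Step
negStep m2 = p2
negStep m1 = p1
negStep p1 = m1
negStep p2 = m2

Walk : Set
Walk = List Step

rev : Walk → Walk
rev a = reverse (map negStep a)

goA : ℤ → Walk → Bool
goA h [] = does (h ≟ + 0)
goA h (s ∷ w) = does (+ 0 ≤? (h + val s)) ∧ goA (h + val s) w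

isA : Walk → Bool
isA = goA (+ 0)

goB : ℤ → Walk → Bool
goB h [] = false
goB h (s ∷ []) = does ((h + val s) ≟ + 1)
goB h (s ∷ t ∷ w) =
  does (+ 0 <? (h + val s)) ∧ not (does ((h + val s) ≟ + 1)) ∧ goB (h + val s) (t ∷ w)

isB : Walk → Bool
isB = goB (+ 0)

-- from 0 to 0, positive except at the two extremities, visits 1
-- (the Bool records whether height 1 has been visited so far)
goC : ℤ → Bool → Walk → Bool
goC h seen [] = false
goC h seen (s ∷ []) = does ((h + val s) ≟ + 0) ∧ seen
goC h seen (s ∷ t ∷ w) =
  does (+ 0 <? (h + val s)) ∧ goC (h + val s) (seen ∨ does ((h + val s) ≟ + 1)) (t ∷ w)

isC : Walk → Bool
isC = goC (+ 0) false

-- The map Φ, as a relation  PhiRel q x y  meaning Φ(q) = (x , y),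
-- with  nothing  standing for the formal symbol ε.

open import Data.Bool using (T)

data PhiRel : Walk → Maybe Walk → Maybe Walk → Set where
  case-i   : PhiRel (p1 ∷ m1 ∷ []) nothing nothing
  case-ii  : ∀ b₁ c a b₂ → T (isB b₁) → T (isC c) → T (isA a) → T (isB b₂) →
             PhiRel (b₁ ++ c ++ a ++ rev b₂) (just (rev c)) (just (b₁ ++ a ++ rev b₂))
  case-iii : ∀ b₁ b₂ a → T (isB b₁) → T (isB b₂) → T (isA a) →
             PhiRel (b₁ ++ b₂ ++ a ++ (m2 ∷ [])) nothing (just (b₁ ++ rev a ++ rev b₂))
  case-iv1 : ∀ a b → T (isA a) → T (isB b) →
             PhiRel (p2 ∷ a ++ rev b ++ (m1 ∷ [])) (just (b ++ rev a ++ (m1 ∷ []))) nothing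
  case-iv2 : ∀ b₁ a₁ a₂ b₂ → T (isB b₁) → T (isA a₁) → T (isA a₂) → T (isB b₂) →
             PhiRel (b₁ ++ (p2 ∷ a₁ ++ (m2 ∷ a₂ ++ rev b₂)))
                    (just (b₁ ++ a₁ ++ b₂ ++ rev a₂ ++ (m2 ∷ []))) nothing

data BTree : Set where
  leaf : BTree
  node : BTree → BTree → BTree

mutual
  data TreeOf : Walk → BTree → Set where
    mk : ∀ {q x y l r} → PhiRel q x y → ChildOf x l → ChildOf y r → TreeOf q (node l r)

  data ChildOf : Maybe Walk → BTree → Set where
    eps  : ChildOf nothing leaf
    walk : ∀ {q t} → TreeOf q t → ChildOf (just q) t

isLeaf : BTree → Bool
isLeaf leaf = true
isLeaf (node _ _) = false

doubleLeaves : BTree → ℕ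
doubleLeaves leaf = 0
doubleLeaves (node leaf leaf) = 2
doubleLeaves (node l r) = doubleLeaves l ℕ.+ doubleLeaves r

leftLeaves : BTree → ℕ
leftLeaves leaf = 0
leftLeaves (node l r) =
  (if isLeaf l ∧ not (isLeaf r) then 1 else 0) ℕ.+ leftLeaves l ℕ.+ leftLeaves r

rightLeaves : BTree → ℕ
rightLeaves leaf = 0
rightLeaves (node l r) =
  (if isLeaf r ∧ not (isLeaf l) then 1 else 0) ℕ.+ rightLeaves l ℕ.+ rightLeaves r

isEven : ℤ → Bool
isEven h = does (∣ h ∣ ℕ.% 2 ℕ.≟ 0)

countSteps : (Bool → Step → Bool) → ℤ → Walk → ℕ
countSteps P h [] = 0
countSteps P h (s ∷ w) =
  (if P (isEven h) s then 1 else 0) ℕ.+ countSteps P (h + val s) w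

pm1 : Bool → Step → Bool
pm1 _ m1 = true
pm1 _ p1 = true
pm1 _ _  = false

oddP2-evenM2 : Bool → Step → Bool
oddP2-evenM2 false p2 = true
oddP2-evenM2 true  m2 = true
oddP2-evenM2 _ _ = false

oddM2-evenP2 : Bool → Step → Bool
oddM2-evenP2 false m2 = true
oddM2-evenP2 true  p2 = true
oddM2-evenP2 _ _ = false

-- Sort the steps of a walk into three kinds: the ±1-steps and the two classes of ±2-steps of the
-- statement. Seen from an odd height the two ±2-kinds trade places; hence A- and C-walks, whose
-- displacement is even, leave the kinds of the steps after them unchanged, B-walks mirror them, and
-- reversing a walk mirrors its counts. With these rules each case of Φ is a bookkeeping identity:
-- the kind-counts of p are those of Φ₁(p) and Φ₂(p) plus the leaves the node gains, so induction
-- along T(p) gives the three equalities. Summed over the kinds it says that Φ loses one step per ε,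
-- so Φ shortens walks and T(p) exists by well-founded recursion, once every C-walk other than
-- (+1,−1) is cut into one of the forms (ii)–(iv.2) at its first and last visits to height 1.

module Submission where

open import Defs
open import Data.Bool using (Bool; true; false; T; not; _∧_; _xor_; if_then_else_)
open import Data.Bool.Properties using (not-involutive; T-∧)
open import Data.Nat as ℕ using (ℕ; zero; suc; _+_)
open import Data.Nat.Tactic.RingSolver using (solve-∀)
import Data.Nat.Properties as ℕ
open import Data.Nat.Induction using (<-wellFounded)
open import Induction.WellFounded using (Acc; acc)
open import Data.Integer as ℤ using (ℤ; +_; -[1+_]; -_)
import Data.Integer.Properties as ℤ
open import Data.List using ([]; _∷_; _++_; [_]; length; map; reverse)
import Data.List.Properties as List
open import Data.Maybe using (Maybe; just; nothing; is-nothing; maybe)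
open import Data.Maybe.Relation.Unary.All using (All; just; nothing)
open import Function using (_∘_; id)
open import Relation.Binary.PropositionalEquality hiding ([_])
open ≡-Reasoning
open import Relation.Nullary using (Dec; yes; no; does; ¬_)
open import Data.Unit using (tt)
open import Data.Empty using (⊥-elim)
open import Data.Product using (Σ-syntax; ∃; ∃₂; _×_; _,_; proj₁; proj₂)
open import Data.Sum using (_⊎_; inj₁; inj₂)
open import Function.Bundles using (Equivalence)
open import Algebra.Properties.CommutativeSemigroup ℕ.+-commutativeSemigroup
  using (x∙yz≈y∙xz; xy∙z≈xz∙y)
import Algebra.Properties.CommutativeSemigroup ℤ.+-commutativeSemigroup as ℤ+

data Kind : Set where
  double left right : Kind

mirror : Kind → Kind
mirror double = double
mirror left   = right
mirror right  = left

mirror-involutive : ∀ k → mirror (mirror k) ≡ k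
mirror-involutive double = refl
mirror-involutive left   = refl
mirror-involutive right  = refl

ofKind : Kind → Bool → Step → Bool
ofKind double = pm1
ofKind left   = oddP2-evenM2
ofKind right  = oddM2-evenP2

leaves : Kind → BTree → ℕ
leaves double = doubleLeaves
leaves left   = leftLeaves
leaves right  = rightLeaves

leaves-leaf : ∀ k → leaves k leaf ≡ 0
leaves-leaf double = refl
leaves-leaf left   = refl
leaves-leaf right  = refl

-- nodeLeaves l r k : the leaves of kind k among two siblings, l (r) telling whether the left (right) one is a leaf.
nodeLeaves : Bool → Bool → Kind → ℕ
nodeLeaves true  true  double = 2
nodeLeaves true  false left   = 1
nodeLeaves false true  right  = 1
nodeLeaves _     _     _      = 0

leaves-node : ∀ k l r → leaves k (node l r) ≡ nodeLeaves (isLeaf l) (isLeaf r) k + leaves k l + leaves k r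
leaves-node double leaf       leaf       = refl
leaves-node double leaf       (node _ _) = refl
leaves-node double (node _ _) leaf       = refl
leaves-node double (node _ _) (node _ _) = refl
leaves-node left   leaf       leaf       = refl
leaves-node left   leaf       (node _ _) = refl
leaves-node left   (node _ _) leaf       = refl
leaves-node left   (node _ _) (node _ _) = refl
leaves-node right  leaf       leaf       = refl
leaves-node right  leaf       (node _ _) = refl
leaves-node right  (node _ _) leaf       = refl
leaves-node right  (node _ _) (node _ _) = refl

oddStep : Step → Bool
oddStep m2 = false
oddStep m1 = true
oddStep p1 = true
oddStep p2 = false

isEven-suc : ∀ n → isEven (+ suc n) ≡ not (isEven (+ n))
isEven-suc zero          = refl
isEven-suc (suc zero)    = refl
isEven-suc (suc (suc n)) = isEven-suc n   -- (n + 2) % 2 computes to n % 2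

isEven-+1 : ∀ h → isEven (h ℤ.+ + 1) ≡ not (isEven h)
isEven-+1 (+ n)            = trans (cong (isEven ∘ +_) (ℕ.+-comm n 1)) (isEven-suc n)
isEven-+1 -[1+ zero ]      = refl
isEven-+1 -[1+ suc n ]     =
  sym (trans (cong not (isEven-suc (suc n))) (not-involutive _))

isEven-−1 : ∀ h → isEven (h ℤ.+ - + 1) ≡ not (isEven h)
isEven-−1 (+ zero)    = refl
isEven-−1 (+ suc n)   = sym (trans (cong not (isEven-suc n)) (not-involutive _))
isEven-−1 -[1+ n ] rewrite ℕ.+-identityʳ n = isEven-suc (suc n)

isEven-+2 : ∀ h → isEven (h ℤ.+ + 2) ≡ isEven h
isEven-+2 (+ n)                  = cong (isEven ∘ +_) (ℕ.+-comm n 2)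
isEven-+2 -[1+ zero ]            = refl
isEven-+2 -[1+ suc zero ]        = refl
isEven-+2 -[1+ suc (suc n) ]     = refl

isEven-−2 : ∀ h → isEven (h ℤ.+ - + 2) ≡ isEven h
isEven-−2 (+ zero)          = refl
isEven-−2 (+ suc zero)      = refl
isEven-−2 (+ suc (suc n))   = refl
isEven-−2 -[1+ n ] rewrite ℕ.+-comm n 1 = refl

isEven-step : ∀ h s → isEven (h ℤ.+ val s) ≡ oddStep s xor isEven h
isEven-step h m2 = isEven-−2 h
isEven-step h m1 = isEven-−1 h
isEven-step h p1 = isEven-+1 h
isEven-step h p2 = isEven-+2 h

stepKind : Step → Kind → Kind
stepKind s k = if oddStep s then mirror k else k

-- count k w counts the steps of w of kind k when w starts at an even height.
-- From an odd height the kinds left and right exchange roles, hence an odd step mirrors k.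
count : Kind → Walk → ℕ
count k []      = 0
count k (s ∷ w) = (if ofKind k true s then 1 else 0) + count (stepKind s k) w

atParity : Bool → Kind → Kind
atParity true  k = k
atParity false k = mirror k

ofKind-atParity : ∀ k e s → ofKind k e s ≡ ofKind (atParity e k) true s
ofKind-atParity k      true  s  = refl
ofKind-atParity double false m2 = refl
ofKind-atParity double false m1 = refl
ofKind-atParity double false p1 = refl
ofKind-atParity double false p2 = refl
ofKind-atParity left   false m2 = refl
ofKind-atParity left   false m1 = refl
ofKind-atParity left   false p1 = refl
ofKind-atParity left   false p2 = refl
ofKind-atParity right  false m2 = refl
ofKind-atParity right  false m1 = refl
ofKind-atParity right  false p1 = refl
ofKind-atParity right  false p2 = refl

atParity-xor : ∀ s e k → atParity (oddStep s xor e) k ≡ stepKind s (atParity e k)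
atParity-xor m2 e     k = refl
atParity-xor m1 true  k = refl
atParity-xor m1 false k = sym (mirror-involutive k)
atParity-xor p1 true  k = refl
atParity-xor p1 false k = sym (mirror-involutive k)
atParity-xor p2 e     k = refl

atParity-step : ∀ h s k → atParity (isEven (h ℤ.+ val s)) k ≡ stepKind s (atParity (isEven h) k)
atParity-step h s k = trans (cong (λ e → atParity e k) (isEven-step h s)) (atParity-xor s (isEven h) k)

countSteps≡count : ∀ k h w → countSteps (ofKind k) h w ≡ count (atParity (isEven h) k) w
countSteps≡count k h []      = refl
countSteps≡count k h (s ∷ w) =
  cong₂ _+_ (cong (λ b → if b then 1 else 0) (ofKind-atParity k (isEven h) s))
            (trans (countSteps≡count k (h ℤ.+ val s) w) (cong (λ j → count j w) (atParity-step h s k)))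

walkKind : Walk → Kind → Kind
walkKind []      k = k
walkKind (s ∷ w) k = walkKind w (stepKind s k)

walkKind-++ : ∀ u v k → walkKind (u ++ v) k ≡ walkKind v (walkKind u k)
walkKind-++ []      v k = refl
walkKind-++ (s ∷ u) v k = walkKind-++ u v (stepKind s k)

count-++ : ∀ k u v → count k (u ++ v) ≡ count k u + count (walkKind u k) v
count-++ k []      v = refl
count-++ k (s ∷ u) v =
  trans (cong (_+_ b) (count-++ (stepKind s k) u v)) (sym (ℕ.+-assoc b _ _))
  where b = if ofKind k true s then 1 else 0

rev-∷ : ∀ s w → rev (s ∷ w) ≡ rev w ++ [ negStep s ]
rev-∷ s w = List.unfold-reverse (negStep s) (map negStep w)

negStep-involutive : ∀ s → negStep (negStep s) ≡ s
negStep-involutive m2 = refl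
negStep-involutive m1 = refl
negStep-involutive p1 = refl
negStep-involutive p2 = refl

rev-involutive : ∀ w → rev (rev w) ≡ w
rev-involutive w = begin
  reverse (map negStep (reverse (map negStep w))) ≡⟨ cong reverse (List.reverse-map negStep (map negStep w)) ⟩
  reverse (reverse (map negStep (map negStep w))) ≡⟨ List.reverse-involutive _ ⟩
  map negStep (map negStep w)                     ≡⟨ List.map-∘ w ⟨
  map (negStep ∘ negStep) w                       ≡⟨ List.map-cong negStep-involutive w ⟩
  map id w                                        ≡⟨ List.map-id w ⟩
  w                                               ∎

rev-++ : ∀ u v → rev (u ++ v) ≡ rev v ++ rev u
rev-++ u v = trans (cong reverse (List.map-++ negStep u v)) (List.reverse-++ (map negStep u) (map negStep v))

rev-split : ∀ {w} u v → rev w ≡ u ++ v → w ≡ rev v ++ rev u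
rev-split {w} u v e = trans (sym (rev-involutive w)) (trans (cong rev e) (rev-++ u v))

stepKind-negStep : ∀ s k → stepKind (negStep s) (stepKind s k) ≡ k
stepKind-negStep m2 k = refl
stepKind-negStep m1 k = mirror-involutive k
stepKind-negStep p1 k = mirror-involutive k
stepKind-negStep p2 k = refl

stepKind-mirror : ∀ s k → stepKind s (mirror k) ≡ mirror (stepKind s k)
stepKind-mirror m2 k = refl
stepKind-mirror m1 k = refl
stepKind-mirror p1 k = refl
stepKind-mirror p2 k = refl

ofKind-negStep : ∀ s k → ofKind (stepKind s k) true (negStep s) ≡ ofKind (mirror k) true s
ofKind-negStep m2 double = refl
ofKind-negStep m2 left   = refl
ofKind-negStep m2 right  = refl
ofKind-negStep m1 double = refl
ofKind-negStep m1 left   = refl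
ofKind-negStep m1 right  = refl
ofKind-negStep p1 double = refl
ofKind-negStep p1 left   = refl
ofKind-negStep p1 right  = refl
ofKind-negStep p2 double = refl
ofKind-negStep p2 left   = refl
ofKind-negStep p2 right  = refl

walkKind-rev : ∀ w k → walkKind (rev w) (walkKind w k) ≡ k
walkKind-rev []      k = refl
walkKind-rev (s ∷ w) k = begin
  walkKind (rev (s ∷ w)) j               ≡⟨ cong (λ u → walkKind u j) (rev-∷ s w) ⟩
  walkKind (rev w ++ [ negStep s ]) j    ≡⟨ walkKind-++ (rev w) [ negStep s ] j ⟩
  stepKind (negStep s) (walkKind (rev w) j) ≡⟨ cong (stepKind (negStep s)) (walkKind-rev w (stepKind s k)) ⟩
  stepKind (negStep s) (stepKind s k)     ≡⟨ stepKind-negStep s k ⟩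
  k                                       ∎
  where j = walkKind w (stepKind s k)

count-rev : ∀ w k → count (walkKind w k) (rev w) ≡ count (mirror k) w
count-rev []      k = refl
count-rev (s ∷ w) k = begin
  count (walkKind w j) (rev (s ∷ w))
    ≡⟨ cong (count (walkKind w j)) (rev-∷ s w) ⟩
  count (walkKind w j) (rev w ++ [ negStep s ])
    ≡⟨ count-++ (walkKind w j) (rev w) [ negStep s ] ⟩
  count (walkKind w j) (rev w) + count (walkKind (rev w) (walkKind w j)) [ negStep s ]
    ≡⟨ cong₂ _+_ (count-rev w j) (cong (λ i → count i [ negStep s ]) (walkKind-rev w j)) ⟩
  count (mirror j) w + count j [ negStep s ]
    ≡⟨ ℕ.+-comm _ (count j [ negStep s ]) ⟩
  count j [ negStep s ] + count (mirror j) w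
    ≡⟨ cong₂ _+_ (trans (ℕ.+-identityʳ _) (cong (λ b → if b then 1 else 0) (ofKind-negStep s k)))
                   (cong (λ i → count i w) (sym (stepKind-mirror s k))) ⟩
  count (mirror k) (s ∷ w) ∎
  where j = stepKind s k

endHeight : ℤ → Walk → ℤ
endHeight h []      = h
endHeight h (s ∷ w) = endHeight (h ℤ.+ val s) w

walkKind-endHeight : ∀ h w k → walkKind w (atParity (isEven h) k) ≡ atParity (isEven (endHeight h w)) k
walkKind-endHeight h []      k = refl
walkKind-endHeight h (s ∷ w) k =
  trans (cong (walkKind w) (sym (atParity-step h s k))) (walkKind-endHeight (h ℤ.+ val s) w k)

∧-proj₁ : ∀ {x y} → T (x ∧ y) → T x
∧-proj₁ = proj₁ ∘ Equivalence.to T-∧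

∧-proj₂ : ∀ {x y} → T (x ∧ y) → T y
∧-proj₂ = proj₂ ∘ Equivalence.to T-∧

∧-intro : ∀ {x y} → T x → T y → T (x ∧ y)
∧-intro a b = Equivalence.from T-∧ (a , b)

does⇒ : ∀ {A : Set} (a? : Dec A) → T (does a?) → A
does⇒ (yes a) _ = a

⇒does : ∀ {A : Set} (a? : Dec A) → A → T (does a?)
⇒does (yes _) _ = tt
⇒does (no ¬a) a = ¬a a

⇒not-does : ∀ {A : Set} (a? : Dec A) → ¬ A → T (not (does a?))
⇒not-does (yes a) ¬a = ¬a a
⇒not-does (no _)  _  = tt

goA-ends-at-0 : ∀ h w → T (goA h w) → endHeight h w ≡ + 0
goA-ends-at-0 h []      A = does⇒ (h ℤ.≟ + 0) A
goA-ends-at-0 h (s ∷ w) A = goA-ends-at-0 (h ℤ.+ val s) w (∧-proj₂ A)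

goB-ends-at-1 : ∀ h w → T (goB h w) → endHeight h w ≡ + 1
goB-ends-at-1 h (s ∷ [])    B = does⇒ (h ℤ.+ val s ℤ.≟ + 1) B
goB-ends-at-1 h (s ∷ t ∷ w) B = goB-ends-at-1 (h ℤ.+ val s) (t ∷ w) (∧-proj₂ (∧-proj₂ {does (+ 0 ℤ.<? h ℤ.+ val s)} B))

goC-ends-at-0 : ∀ h seen w → T (goC h seen w) → endHeight h w ≡ + 0
goC-ends-at-0 h seen (s ∷ [])    C = does⇒ (h ℤ.+ val s ℤ.≟ + 0) (∧-proj₁ C)
goC-ends-at-0 h seen (s ∷ t ∷ w) C = goC-ends-at-0 (h ℤ.+ val s) _ (t ∷ w) (∧-proj₂ C)

record PreservesKinds (w : Walk) : Set where
  constructor preserving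
  field preserves : ∀ k → walkKind w k ≡ k

record MirrorsKinds (w : Walk) : Set where
  constructor mirroring
  field mirrors : ∀ k → walkKind w k ≡ mirror k

open PreservesKinds
open MirrorsKinds

preserves-A : ∀ {a} → T (isA a) → PreservesKinds a
preserves-A {a} A = preserving λ k →
  trans (walkKind-endHeight (+ 0) a k) (cong (λ h → atParity (isEven h) k) (goA-ends-at-0 (+ 0) a A))

mirrors-B : ∀ {b} → T (isB b) → MirrorsKinds b
mirrors-B {b} B = mirroring λ k →
  trans (walkKind-endHeight (+ 0) b k) (cong (λ h → atParity (isEven h) k) (goB-ends-at-1 (+ 0) b B))

preserves-C : ∀ {c} → T (isC c) → PreservesKinds c
preserves-C {c} C = preserving λ k →
  trans (walkKind-endHeight (+ 0) c k) (cong (λ h → atParity (isEven h) k) (goC-ends-at-0 (+ 0) false c C))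

preserves-rev : ∀ {w} → PreservesKinds w → PreservesKinds (rev w)
preserves-rev {w} P = preserving λ k → trans (cong (walkKind (rev w)) (sym (preserves P k))) (walkKind-rev w k)

mirrors-rev : ∀ {w} → MirrorsKinds w → MirrorsKinds (rev w)
mirrors-rev {w} M = mirroring λ k →
  trans (cong (walkKind (rev w)) (sym (trans (mirrors M (mirror k)) (mirror-involutive k)))) (walkKind-rev w (mirror k))

count-++-preserving : ∀ {u} → PreservesKinds u → ∀ k v → count k (u ++ v) ≡ count k u + count k v
count-++-preserving {u} P k v = trans (count-++ k u v) (cong (λ j → count k u + count j v) (preserves P k))

count-++-mirroring : ∀ {u} → MirrorsKinds u → ∀ k v → count k (u ++ v) ≡ count k u + count (mirror k) v
count-++-mirroring {u} M k v = trans (count-++ k u v) (cong (λ j → count k u + count j v) (mirrors M k))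

count-rev-preserving : ∀ {w} → PreservesKinds w → ∀ k → count k (rev w) ≡ count (mirror k) w
count-rev-preserving {w} P k = trans (cong (λ j → count j (rev w)) (sym (preserves P k))) (count-rev w k)

count-rev-mirroring : ∀ {w} → MirrorsKinds w → ∀ k → count k (rev w) ≡ count k w
count-rev-mirroring {w} M k = begin
  count k (rev w)                         ≡⟨ cong (λ j → count j (rev w)) (trans (mirrors M (mirror k)) (mirror-involutive k)) ⟨
  count (walkKind w (mirror k)) (rev w)      ≡⟨ count-rev w (mirror k) ⟩
  count (mirror (mirror k)) w             ≡⟨ cong (λ j → count j w) (mirror-involutive k) ⟩
  count k w                               ∎

count-++-mirroring′ : ∀ {u} → MirrorsKinds u → ∀ k v → count (mirror k) (u ++ v) ≡ count (mirror k) u + count k v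
count-++-mirroring′ {u} M k v =
  trans (count-++-mirroring M (mirror k) v) (cong (λ j → count (mirror k) u + count j v) (mirror-involutive k))

count-rev-preserving′ : ∀ {w} → PreservesKinds w → ∀ k → count (mirror k) (rev w) ≡ count k w
count-rev-preserving′ {w} P k = trans (count-rev-preserving P (mirror k)) (cong (λ j → count j w) (mirror-involutive k))

preserves-±2 : ∀ {s} → oddStep s ≡ false → PreservesKinds [ s ]
preserves-±2 {m2} _ = preserving λ _ → refl
preserves-±2 {p2} _ = preserving λ _ → refl

count-mirror-negStep : ∀ s k → count (mirror k) [ s ] ≡ count (stepKind s k) [ negStep s ]
count-mirror-negStep s k = cong (λ b → (if b then 1 else 0) + 0) (sym (ofKind-negStep s k))

leftLeaf≡count-m2 : ∀ k → nodeLeaves true false k ≡ count k [ m2 ]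
leftLeaf≡count-m2 double = refl
leftLeaf≡count-m2 left   = refl
leftLeaf≡count-m2 right  = refl

rightLeaf≡count-p2 : ∀ k → nodeLeaves false true k ≡ count k [ p2 ]
rightLeaf≡count-p2 double = refl
rightLeaf≡count-p2 left   = refl
rightLeaf≡count-p2 right  = refl

count-Φ-ii : ∀ b₁ c a b₂ → MirrorsKinds b₁ → PreservesKinds c → ∀ k →
             count k (b₁ ++ c ++ a ++ rev b₂) ≡ count k (rev c) + count k (b₁ ++ a ++ rev b₂)
count-Φ-ii b₁ c a b₂ B₁ C k = begin
  count k (b₁ ++ c ++ a ++ rev b₂)
    ≡⟨ count-++-mirroring B₁ k _ ⟩
  count k b₁ + count k′ (c ++ a ++ rev b₂)
    ≡⟨ cong (_+_ (count k b₁)) (count-++-preserving C k′ _) ⟩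
  count k b₁ + (count k′ c + count k′ (a ++ rev b₂))
    ≡⟨ x∙yz≈y∙xz (count k b₁) (count k′ c) _ ⟩
  count k′ c + (count k b₁ + count k′ (a ++ rev b₂))
    ≡⟨ cong₂ _+_ (count-rev-preserving C k) (count-++-mirroring B₁ k _) ⟨
  count k (rev c) + count k (b₁ ++ a ++ rev b₂) ∎
  where k′ = mirror k

count-Φ-iii : ∀ b₁ b₂ a → MirrorsKinds b₁ → MirrorsKinds b₂ → PreservesKinds a → ∀ k →
              count k (b₁ ++ b₂ ++ a ++ [ m2 ]) ≡ nodeLeaves true false k + 0 + count k (b₁ ++ rev a ++ rev b₂)
count-Φ-iii b₁ b₂ a B₁ B₂ A k = begin
  count k (b₁ ++ b₂ ++ a ++ [ m2 ])
    ≡⟨ count-++-mirroring B₁ k _ ⟩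
  count k b₁ + count k′ (b₂ ++ a ++ [ m2 ])
    ≡⟨ cong (_+_ (count k b₁)) (count-++-mirroring′ B₂ k _) ⟩
  count k b₁ + (count k′ b₂ + count k (a ++ [ m2 ]))
    ≡⟨ cong (λ n → count k b₁ + (count k′ b₂ + n)) (count-++-preserving A k _) ⟩
  count k b₁ + (count k′ b₂ + (count k a + count k [ m2 ]))
    ≡⟨ rearrange (count k b₁) (count k′ b₂) (count k a) (count k [ m2 ]) ⟩
  count k [ m2 ] + 0 + (count k b₁ + (count k a + count k′ b₂))
    ≡⟨ cong₂ (λ m n → m + 0 + (count k b₁ + n)) (leftLeaf≡count-m2 k)
             (cong₂ _+_ (count-rev-preserving′ A k) (count-rev-mirroring B₂ k′)) ⟨
  nodeLeaves true false k + 0 + (count k b₁ + (count k′ (rev a) + count k′ (rev b₂)))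
    ≡⟨ cong (λ n → nodeLeaves true false k + 0 + (count k b₁ + n)) (count-++-preserving (preserves-rev A) k′ _) ⟨
  nodeLeaves true false k + 0 + (count k b₁ + count k′ (rev a ++ rev b₂))
    ≡⟨ cong (_+_ (nodeLeaves true false k + 0)) (count-++-mirroring B₁ k _) ⟨
  nodeLeaves true false k + 0 + count k (b₁ ++ rev a ++ rev b₂) ∎
  where
  k′ = mirror k
  rearrange : ∀ b c a m → b + (c + (a + m)) ≡ m + 0 + (b + (a + c))
  rearrange = solve-∀

count-Φ-iv1 : ∀ a b → PreservesKinds a → MirrorsKinds b → ∀ k →
              count k (p2 ∷ a ++ rev b ++ [ m1 ]) ≡ nodeLeaves false true k + count k (b ++ rev a ++ [ m1 ]) + 0
count-Φ-iv1 a b A B k = begin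
  count k ([ p2 ] ++ a ++ rev b ++ [ m1 ])
    ≡⟨ count-++-preserving (preserves-±2 {p2} refl) k (a ++ rev b ++ [ m1 ]) ⟩
  count k [ p2 ] + count k (a ++ rev b ++ [ m1 ])
    ≡⟨ cong (_+_ (count k [ p2 ])) (count-++-preserving A k _) ⟩
  count k [ p2 ] + (count k a + count k (rev b ++ [ m1 ]))
    ≡⟨ cong (λ n → count k [ p2 ] + (count k a + n)) (count-++-mirroring (mirrors-rev B) k _) ⟩
  count k [ p2 ] + (count k a + (count k (rev b) + count k′ [ m1 ]))
    ≡⟨ cong (λ n → count k [ p2 ] + (count k a + (n + count k′ [ m1 ]))) (count-rev-mirroring B k) ⟩
  count k [ p2 ] + (count k a + (count k b + count k′ [ m1 ]))
    ≡⟨ rearrange (count k [ p2 ]) (count k a) (count k b) (count k′ [ m1 ]) ⟩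
  count k [ p2 ] + (count k b + (count k a + count k′ [ m1 ])) + 0
    ≡⟨ cong₂ (λ r n → r + (count k b + n) + 0) (rightLeaf≡count-p2 k)
             (cong (λ n → n + count k′ [ m1 ]) (count-rev-preserving′ A k)) ⟨
  nodeLeaves false true k + (count k b + (count k′ (rev a) + count k′ [ m1 ])) + 0
    ≡⟨ cong (λ n → nodeLeaves false true k + (count k b + n) + 0) (count-++-preserving (preserves-rev A) k′ _) ⟨
  nodeLeaves false true k + (count k b + count k′ (rev a ++ [ m1 ])) + 0
    ≡⟨ cong (λ n → nodeLeaves false true k + n + 0) (count-++-mirroring B k _) ⟨
  nodeLeaves false true k + count k (b ++ rev a ++ [ m1 ]) + 0 ∎
  where
  k′ = mirror k
  rearrange : ∀ p a b m → p + (a + (b + m)) ≡ p + (b + (a + m)) + 0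
  rearrange = solve-∀

count-iv2-parent : ∀ b₁ a₁ a₂ b₂ → MirrorsKinds b₁ → PreservesKinds a₁ → PreservesKinds a₂ → MirrorsKinds b₂ →
  ∀ k → let k′ = mirror k in
  count k (b₁ ++ [ p2 ] ++ a₁ ++ [ m2 ] ++ a₂ ++ rev b₂)
    ≡ count k b₁ + (count k [ m2 ] + (count k′ a₁ + (count k [ p2 ] + (count k′ a₂ + count k′ b₂))))
count-iv2-parent b₁ a₁ a₂ b₂ B₁ A₁ A₂ B₂ k = begin
  count k (b₁ ++ [ p2 ] ++ a₁ ++ [ m2 ] ++ a₂ ++ rev b₂)
    ≡⟨ count-++-mirroring B₁ k _ ⟩
  count k b₁ + count k′ ([ p2 ] ++ a₁ ++ [ m2 ] ++ a₂ ++ rev b₂)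
    ≡⟨ cong (_+_ (count k b₁)) (count-++-preserving (preserves-±2 {p2} refl) k′ (a₁ ++ [ m2 ] ++ a₂ ++ rev b₂)) ⟩
  count k b₁ + (count k′ [ p2 ] + count k′ (a₁ ++ [ m2 ] ++ a₂ ++ rev b₂))
    ≡⟨ cong (λ n → count k b₁ + (count k′ [ p2 ] + n)) (count-++-preserving A₁ k′ _) ⟩
  count k b₁ + (count k′ [ p2 ] + (count k′ a₁ + count k′ ([ m2 ] ++ a₂ ++ rev b₂)))
    ≡⟨ cong (λ n → count k b₁ + (count k′ [ p2 ] + (count k′ a₁ + n)))
            (count-++-preserving (preserves-±2 {m2} refl) k′ (a₂ ++ rev b₂)) ⟩
  count k b₁ + (count k′ [ p2 ] + (count k′ a₁ + (count k′ [ m2 ] + count k′ (a₂ ++ rev b₂))))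
    ≡⟨ cong (λ n → count k b₁ + (count k′ [ p2 ] + (count k′ a₁ + (count k′ [ m2 ] + n))))
            (trans (count-++-preserving A₂ k′ _) (cong (_+_ (count k′ a₂)) (count-rev-mirroring B₂ k′))) ⟩
  count k b₁ + (count k′ [ p2 ] + (count k′ a₁ + (count k′ [ m2 ] + (count k′ a₂ + count k′ b₂))))
    ≡⟨ cong₂ (λ m p → count k b₁ + (m + (count k′ a₁ + (p + (count k′ a₂ + count k′ b₂)))))
             (count-mirror-negStep p2 k) (count-mirror-negStep m2 k) ⟩
  count k b₁ + (count k [ m2 ] + (count k′ a₁ + (count k [ p2 ] + (count k′ a₂ + count k′ b₂)))) ∎
  where k′ = mirror k

count-iv2-child : ∀ b₁ a₁ a₂ b₂ → MirrorsKinds b₁ → PreservesKinds a₁ → PreservesKinds a₂ → MirrorsKinds b₂ →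
  ∀ k → let k′ = mirror k in
  count k (b₁ ++ a₁ ++ b₂ ++ rev a₂ ++ [ m2 ])
    ≡ count k b₁ + (count k′ a₁ + (count k′ b₂ + (count k′ a₂ + count k [ m2 ])))
count-iv2-child b₁ a₁ a₂ b₂ B₁ A₁ A₂ B₂ k = begin
  count k (b₁ ++ a₁ ++ b₂ ++ rev a₂ ++ [ m2 ])
    ≡⟨ count-++-mirroring B₁ k _ ⟩
  count k b₁ + count k′ (a₁ ++ b₂ ++ rev a₂ ++ [ m2 ])
    ≡⟨ cong (_+_ (count k b₁)) (count-++-preserving A₁ k′ _) ⟩
  count k b₁ + (count k′ a₁ + count k′ (b₂ ++ rev a₂ ++ [ m2 ]))
    ≡⟨ cong (λ n → count k b₁ + (count k′ a₁ + n)) (count-++-mirroring′ B₂ k _) ⟩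
  count k b₁ + (count k′ a₁ + (count k′ b₂ + count k (rev a₂ ++ [ m2 ])))
    ≡⟨ cong (λ n → count k b₁ + (count k′ a₁ + (count k′ b₂ + n)))
            (trans (count-++-preserving (preserves-rev A₂) k _)
                   (cong (λ n → n + count k [ m2 ]) (count-rev-preserving A₂ k))) ⟩
  count k b₁ + (count k′ a₁ + (count k′ b₂ + (count k′ a₂ + count k [ m2 ]))) ∎
  where k′ = mirror k

count-Φ-iv2 : ∀ b₁ a₁ a₂ b₂ → MirrorsKinds b₁ → PreservesKinds a₁ → PreservesKinds a₂ → MirrorsKinds b₂ → ∀ k →
              count k (b₁ ++ (p2 ∷ a₁ ++ (m2 ∷ a₂ ++ rev b₂)))
                ≡ nodeLeaves false true k + count k (b₁ ++ a₁ ++ b₂ ++ rev a₂ ++ [ m2 ]) + 0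
count-Φ-iv2 b₁ a₁ a₂ b₂ B₁ A₁ A₂ B₂ k = begin
  count k (b₁ ++ [ p2 ] ++ a₁ ++ [ m2 ] ++ a₂ ++ rev b₂)
    ≡⟨ count-iv2-parent b₁ a₁ a₂ b₂ B₁ A₁ A₂ B₂ k ⟩
  count k b₁ + (count k [ m2 ] + (count k′ a₁ + (count k [ p2 ] + (count k′ a₂ + count k′ b₂))))
    ≡⟨ rearrange (count k b₁) (count k [ m2 ]) (count k′ a₁) (count k [ p2 ]) (count k′ a₂) (count k′ b₂) ⟩
  count k [ p2 ] + (count k b₁ + (count k′ a₁ + (count k′ b₂ + (count k′ a₂ + count k [ m2 ])))) + 0
    ≡⟨ cong₂ (λ r n → r + n + 0) (rightLeaf≡count-p2 k) (count-iv2-child b₁ a₁ a₂ b₂ B₁ A₁ A₂ B₂ k) ⟨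
  nodeLeaves false true k + count k (b₁ ++ a₁ ++ b₂ ++ rev a₂ ++ [ m2 ]) + 0 ∎
  where
  k′ = mirror k
  rearrange : ∀ b m a₁ p a₂ b₂ → b + (m + (a₁ + (p + (a₂ + b₂)))) ≡ p + (b + (a₁ + (b₂ + (a₂ + m)))) + 0
  rearrange = solve-∀

count-Φ : ∀ {q x y} → PhiRel q x y → ∀ k →
  count k q ≡ nodeLeaves (is-nothing x) (is-nothing y) k + maybe (count k) 0 x + maybe (count k) 0 y
count-Φ case-i double = refl
count-Φ case-i left   = refl
count-Φ case-i right  = refl
count-Φ (case-ii b₁ c a b₂ B₁ C _ _) = count-Φ-ii b₁ c a b₂ (mirrors-B B₁) (preserves-C C)
count-Φ (case-iii b₁ b₂ a B₁ B₂ A)   = count-Φ-iii b₁ b₂ a (mirrors-B B₁) (mirrors-B B₂) (preserves-A A)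
count-Φ (case-iv1 a b A B)           = count-Φ-iv1 a b (preserves-A A) (mirrors-B B)
count-Φ (case-iv2 b₁ a₁ a₂ b₂ B₁ A₁ A₂ B₂) =
  count-Φ-iv2 b₁ a₁ a₂ b₂ (mirrors-B B₁) (preserves-A A₁) (preserves-A A₂) (mirrors-B B₂)

childOf-isLeaf : ∀ {x t} → ChildOf x t → is-nothing x ≡ isLeaf t
childOf-isLeaf eps              = refl
childOf-isLeaf (walk (mk _ _ _)) = refl

mutual
  count≡leaves : ∀ {q t} → TreeOf q t → ∀ k → count k q ≡ leaves k t
  count≡leaves {q} (mk {x = x} {y} {l} {r} φ cl cr) k = begin
    count k q
      ≡⟨ count-Φ φ k ⟩
    nodeLeaves (is-nothing x) (is-nothing y) k + maybe (count k) 0 x + maybe (count k) 0 y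
      ≡⟨ cong₂ _+_ (cong₂ _+_ (cong₂ (λ a b → nodeLeaves a b k) (childOf-isLeaf cl) (childOf-isLeaf cr))
                              (childCount≡leaves cl k))
                   (childCount≡leaves cr k) ⟩
    nodeLeaves (isLeaf l) (isLeaf r) k + leaves k l + leaves k r
      ≡⟨ leaves-node k l r ⟨
    leaves k (node l r) ∎

  childCount≡leaves : ∀ {x t} → ChildOf x t → ∀ k → maybe (count k) 0 x ≡ leaves k t
  childCount≡leaves eps      k = sym (leaves-leaf k)
  childCount≡leaves (walk T) k = count≡leaves T k

sumKinds : (Kind → ℕ) → ℕ
sumKinds f = f double + f left + f right

sumKinds-cong : ∀ {f g} → (∀ k → f k ≡ g k) → sumKinds f ≡ sumKinds g
sumKinds-cong f≡g = cong₂ _+_ (cong₂ _+_ (f≡g double) (f≡g left)) (f≡g right)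

sumKinds-+ : ∀ f g → sumKinds (λ k → f k + g k) ≡ sumKinds f + sumKinds g
sumKinds-+ f g = regroup (f double) (g double) (f left) (g left) (f right) (g right)
  where
  regroup : ∀ a a′ b b′ c c′ → a + a′ + (b + b′) + (c + c′) ≡ a + b + c + (a′ + b′ + c′)
  regroup = solve-∀

sumKinds-stepKind : ∀ s f → sumKinds (f ∘ stepKind s) ≡ sumKinds f
sumKinds-stepKind m2 f = refl
sumKinds-stepKind m1 f = xy∙z≈xz∙y (f double) (f right) (f left)
sumKinds-stepKind p1 f = xy∙z≈xz∙y (f double) (f right) (f left)
sumKinds-stepKind p2 f = refl

length≡sumKinds-count : ∀ w → length w ≡ sumKinds (λ k → count k w)
length≡sumKinds-count []      = refl
length≡sumKinds-count (s ∷ w) = begin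
  suc (length w)
    ≡⟨ cong suc (length≡sumKinds-count w) ⟩
  suc (sumKinds (λ k → count k w))
    ≡⟨ cong₂ _+_ (one-kind s) (sumKinds-stepKind s (λ k → count k w)) ⟨
  sumKinds (indicator s) + sumKinds (λ k → count (stepKind s k) w)
    ≡⟨ sumKinds-+ (indicator s) (λ k → count (stepKind s k) w) ⟨
  sumKinds (λ k → count k (s ∷ w)) ∎
  where
  indicator : Step → Kind → ℕ
  indicator s k = if ofKind k true s then 1 else 0
  one-kind : ∀ s → sumKinds (indicator s) ≡ 1
  one-kind m2 = refl
  one-kind m1 = refl
  one-kind p1 = refl
  one-kind p2 = refl

size : Maybe Walk → ℕ
size = maybe length 1

size≡sumKinds : ∀ x → size x ≡ (if is-nothing x then 1 else 0) + sumKinds (λ k → maybe (count k) 0 x)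
size≡sumKinds nothing  = refl
size≡sumKinds (just w) = length≡sumKinds-count w

sumKinds-nodeLeaves : ∀ l r → sumKinds (nodeLeaves l r) ≡ (if l then 1 else 0) + (if r then 1 else 0)
sumKinds-nodeLeaves true  true  = refl
sumKinds-nodeLeaves true  false = refl
sumKinds-nodeLeaves false true  = refl
sumKinds-nodeLeaves false false = refl

-- count-Φ summed over the kinds: Φ keeps every step of q except one for each ε it produces.
length-Φ : ∀ {q x y} → PhiRel q x y → length q ≡ size x + size y
length-Φ {q} {x} {y} φ = begin
  length q
    ≡⟨ length≡sumKinds-count q ⟩
  sumKinds (λ k → count k q)
    ≡⟨ sumKinds-cong (count-Φ φ) ⟩
  sumKinds (λ k → nodeLeaves lx ly k + X k + Y k)
    ≡⟨ sumKinds-+ (λ k → nodeLeaves lx ly k + X k) Y ⟩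
  sumKinds (λ k → nodeLeaves lx ly k + X k) + sumKinds Y
    ≡⟨ cong (_+ sumKinds Y) (sumKinds-+ (nodeLeaves lx ly) X) ⟩
  sumKinds (nodeLeaves lx ly) + sumKinds X + sumKinds Y
    ≡⟨ cong (λ n → n + sumKinds X + sumKinds Y) (sumKinds-nodeLeaves lx ly) ⟩
  (if lx then 1 else 0) + (if ly then 1 else 0) + sumKinds X + sumKinds Y
    ≡⟨ regroup (if lx then 1 else 0) (if ly then 1 else 0) (sumKinds X) (sumKinds Y) ⟩
  ((if lx then 1 else 0) + sumKinds X) + ((if ly then 1 else 0) + sumKinds Y)
    ≡⟨ cong₂ _+_ (size≡sumKinds x) (size≡sumKinds y) ⟨
  size x + size y ∎
  where
  lx = is-nothing x
  ly = is-nothing y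
  X Y : Kind → ℕ
  X k = maybe (count k) 0 x
  Y k = maybe (count k) 0 y
  regroup : ∀ a b c d → a + b + c + d ≡ (a + c) + (b + d)
  regroup = solve-∀

-- Above lo h w h′ : w leads from height h to h′, and every height strictly between
-- its two ends is at least lo (the ends themselves are unconstrained).
data Above (lo : ℤ) : ℤ → Walk → ℤ → Set where
  nil  : ∀ {h} → Above lo h [] h
  one  : ∀ {h s h′} → h ℤ.+ val s ≡ h′ → Above lo h [ s ] h′
  cons : ∀ {h s t w h′} → lo ℤ.≤ h ℤ.+ val s → Above lo (h ℤ.+ val s) (t ∷ w) h′ →
         Above lo h (s ∷ t ∷ w) h′

AWalk BWalk : Walk → Set
AWalk a = Above (+ 0) (+ 0) a (+ 0)
BWalk b = Above (+ 2) (+ 0) b (+ 1)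

Above-++ : ∀ {lo h m h′ u v} → Above lo h u m → lo ℤ.≤ m → Above lo m v h′ → Above lo h (u ++ v) h′
Above-++         nil        _    V   = V
Above-++ {v = []}    (one e)    _    nil = one e
Above-++ {v = _ ∷ _} (one refl) lo≤m V   = cons lo≤m V
Above-++         (cons l U) lo≤m V   = cons l (Above-++ U lo≤m V)

Above-∷ : ∀ {lo h s w h′} → lo ℤ.≤ h ℤ.+ val s → Above lo (h ℤ.+ val s) w h′ → Above lo h (s ∷ w) h′
Above-∷ _ nil          = one refl
Above-∷ l W@(one _)    = cons l W
Above-∷ l W@(cons _ _) = cons l W

1≤2 : + 1 ℤ.≤ + 2
1≤2 = ℤ.+≤+ (ℕ.s≤s ℕ.z≤n)

1≤3 : + 1 ℤ.≤ + 3
1≤3 = ℤ.+≤+ (ℕ.s≤s ℕ.z≤n)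

Above-weaken : ∀ {lo lo′ h w h′} → lo′ ℤ.≤ lo → Above lo h w h′ → Above lo′ h w h′
Above-weaken _     nil        = nil
Above-weaken _     (one e)    = one e
Above-weaken lo′≤lo (cons l W) = cons (ℤ.≤-trans lo′≤lo l) (Above-weaken lo′≤lo W)

Above-shift : ∀ {lo h w h′} k → Above lo h w h′ → Above (lo ℤ.+ k) (h ℤ.+ k) w (h′ ℤ.+ k)
Above-shift k nil = nil
Above-shift {h = h} k (one {s = s} refl) = one (ℤ+.xy∙z≈xz∙y h k (val s))
Above-shift {lo} {h} k (cons {s = s} l W) =
  cons (subst (ℤ._≤_ (lo ℤ.+ k)) (sym (ℤ+.xy∙z≈xz∙y h k (val s))) (ℤ.+-monoˡ-≤ k l))
       (subst (λ h″ → Above (lo ℤ.+ k) h″ _ _) (sym (ℤ+.xy∙z≈xz∙y h k (val s))) (Above-shift k W))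

val-negStep : ∀ s → val (negStep s) ≡ ℤ.- val s
val-negStep m2 = refl
val-negStep m1 = refl
val-negStep p1 = refl
val-negStep p2 = refl

step-back : ∀ h s → h ℤ.+ val s ℤ.+ val (negStep s) ≡ h
step-back h s = begin
  h ℤ.+ val s ℤ.+ val (negStep s)   ≡⟨ cong (ℤ._+_ (h ℤ.+ val s)) (val-negStep s) ⟩
  h ℤ.+ val s ℤ.- val s             ≡⟨ ℤ.+-assoc h (val s) (ℤ.- val s) ⟩
  h ℤ.+ (val s ℤ.- val s)           ≡⟨ cong (ℤ._+_ h) (ℤ.+-inverseʳ (val s)) ⟩
  h ℤ.+ + 0                         ≡⟨ ℤ.+-identityʳ h ⟩
  h                                 ∎

Above-rev : ∀ {lo h w h′} → Above lo h w h′ → Above lo h′ (rev w) h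
Above-rev nil = nil
Above-rev {h = h} (one {s = s} refl) = one (step-back h s)
Above-rev {h = h} (cons {s = s} {t} {w} l W) =
  subst (λ u → Above _ _ u h) (sym (rev-∷ s (t ∷ w))) (Above-++ (Above-rev W) l (one (step-back h s)))

FirstVisit : ℤ → ℤ → Walk → ℤ → Set
FirstVisit lo h w h′ =
  Σ[ s ∈ Step ] ∃₂ λ u v → w ≡ s ∷ u ++ v × Above (ℤ.suc lo) h (s ∷ u) lo × Above lo lo v h′

first-visit : ∀ {lo h w h′} → Above lo h w h′ → FirstVisit lo h w h′ ⊎ Above (ℤ.suc lo) h w h′
first-visit nil     = inj₂ nil
first-visit (one e) = inj₂ (one e)
first-visit {lo} {h} (cons {s = s} {t} {w} l W) with h ℤ.+ val s ℤ.≟ lo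
... | yes refl = inj₁ (s , [] , t ∷ w , refl , one refl , W)
... | no  ≢lo  with first-visit W | ℤ.i<j⇒suc[i]≤j (ℤ.≤∧≢⇒< l (≢lo ∘ sym))
...   | inj₁ (s₀ , u , v , refl , U , V) | lo<h+s = inj₁ (s , s₀ ∷ u , v , refl , cons lo<h+s U , V)
...   | inj₂ W′                          | lo<h+s = inj₂ (cons lo<h+s W′)

leave-0-above-2 : ∀ {s w h′} → Above (+ 2) (+ 0) (s ∷ w) h′ →
                  (w ≡ [] × val s ≡ h′) ⊎ (s ≡ p2 × Above (+ 2) (+ 2) w h′)
leave-0-above-2         (one e)                     = inj₁ (refl , trans (sym (ℤ.+-identityˡ _)) e)
leave-0-above-2 {m2}    (cons () _)
leave-0-above-2 {m1}    (cons () _)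
leave-0-above-2 {p1}    (cons (ℤ.+≤+ (ℕ.s≤s ())) _)
leave-0-above-2 {p2}    (cons _ W)                  = inj₂ (refl , W)

B-shape : ∀ {b} → BWalk b → b ≡ [ p1 ] ⊎ ∃ λ w → b ≡ p2 ∷ w × Above (+ 2) (+ 2) w (+ 1)
B-shape {s ∷ w} B with leave-0-above-2 B
B-shape {p1 ∷ _} B | inj₁ (refl , refl) = inj₁ refl
B-shape {m2 ∷ _} B | inj₁ (refl , ())
B-shape {m1 ∷ _} B | inj₁ (refl , ())
B-shape {p2 ∷ _} B | inj₁ (refl , ())
... | inj₂ (refl , W) = inj₂ (w , refl , W)

climb-0-to-2 : ∀ {s w} → Above (+ 2) (+ 0) (s ∷ w) (+ 2) → s ≡ p2 × Above (+ 2) (+ 2) w (+ 2)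
climb-0-to-2 {s} B with leave-0-above-2 B
climb-0-to-2 {p2} B | inj₁ (refl , refl) = refl , nil
climb-0-to-2 {m2} B | inj₁ (refl , ())
climb-0-to-2 {m1} B | inj₁ (refl , ())
climb-0-to-2 {p1} B | inj₁ (refl , ())
... | inj₂ r = r

ends-with-m2 : ∀ {w} → Above (+ 2) (+ 2) w (+ 0) → ∃ λ x → w ≡ x ++ [ m2 ] × Above (+ 2) (+ 2) x (+ 2)
ends-with-m2 {w} W with rev w in e | Above-rev W
... | s ∷ y | W′ with climb-0-to-2 W′
...   | refl , Y = rev y , rev-split [ p2 ] y e , Above-rev Y

goA-from-Above : ∀ {h w} → Above (+ 0) h w (+ 0) → T (goA h w)
goA-from-Above nil                      = tt
goA-from-Above (one e) rewrite e        = tt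
goA-from-Above {h} (cons {s = s} l W)   = ∧-intro (⇒does (+ 0 ℤ.≤? h ℤ.+ val s) l) (goA-from-Above W)

goB-from-Above : ∀ {h s w} → Above (+ 2) h (s ∷ w) (+ 1) → T (goB h (s ∷ w))
goB-from-Above {h} {s} (one e)    = ⇒does (h ℤ.+ val s ℤ.≟ + 1) e
goB-from-Above {h} {s} (cons l W) =
  ∧-intro (⇒does (+ 0 ℤ.<? h ℤ.+ val s) (ℤ.<-≤-trans (ℤ.+<+ (ℕ.s≤s ℕ.z≤n)) l))
          (∧-intro (⇒not-does (h ℤ.+ val s ℤ.≟ + 1) λ e → 2≰1 (subst (ℤ._≤_ (+ 2)) e l)) (goB-from-Above W))
  where
  2≰1 : ¬ (+ 2 ℤ.≤ + 1)
  2≰1 (ℤ.+≤+ (ℕ.s≤s ()))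

isB-from-Above : ∀ {b} → BWalk b → T (isB b)
isB-from-Above B@(one _)    = goB-from-Above B
isB-from-Above B@(cons _ _) = goB-from-Above B

goC-seen⇒Above : ∀ {h} w → T (goC h true w) → Above (+ 1) h w (+ 0)
goC-seen⇒Above {h} (s ∷ [])    C = one (does⇒ (h ℤ.+ val s ℤ.≟ + 0) (∧-proj₁ C))
goC-seen⇒Above {h} (s ∷ t ∷ w) C =
  cons (ℤ.i<j⇒suc[i]≤j (does⇒ (+ 0 ℤ.<? h ℤ.+ val s) (∧-proj₁ C))) (goC-seen⇒Above (t ∷ w) (∧-proj₂ C))

Above⇒goC-seen : ∀ {h s w} → Above (+ 1) h (s ∷ w) (+ 0) → T (goC h true (s ∷ w))
Above⇒goC-seen {h} {s} (one e)    = ∧-intro (⇒does (h ℤ.+ val s ℤ.≟ + 0) e) tt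
Above⇒goC-seen {h} {s} (cons l W) =
  ∧-intro (⇒does (+ 0 ℤ.<? h ℤ.+ val s) (ℤ.suc[i]≤j⇒i<j l)) (Above⇒goC-seen W)

CSplit : ℤ → Walk → Set
CSplit h w = ∃₂ λ u v → w ≡ u ++ v × Above (+ 1) h u (+ 1) × Above (+ 1) (+ 1) v (+ 0)

goC-unseen⇒split : ∀ {h} w → T (goC h false w) → CSplit h w
goC-unseen⇒split {h} (s ∷ [])    C = ⊥-elim (∧-proj₂ {does (h ℤ.+ val s ℤ.≟ + 0)} C)
goC-unseen⇒split {h} (s ∷ t ∷ w) C =
  step (h ℤ.+ val s ℤ.≟ + 1) (∧-proj₁ C) (∧-proj₂ C) (goC-unseen⇒split (t ∷ w))
  where
  step : (d : Dec (h ℤ.+ val s ≡ + 1)) → T (does (+ 0 ℤ.<? h ℤ.+ val s)) →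
         T (goC (h ℤ.+ val s) (does d) (t ∷ w)) →
         (T (goC (h ℤ.+ val s) false (t ∷ w)) → CSplit (h ℤ.+ val s) (t ∷ w)) → CSplit h (s ∷ t ∷ w)
  step (yes h+s≡1) _ C′ _ =
    [ s ] , t ∷ w , refl , one h+s≡1 ,
    subst (λ h′ → Above (+ 1) h′ (t ∷ w) (+ 0)) h+s≡1 (goC-seen⇒Above (t ∷ w) C′)
  step (no _) 0<h+s C′ rec with rec C′
  ... | u , v , e , U , V = s ∷ u , v , cong (s ∷_) e , Above-∷ (ℤ.i<j⇒suc[i]≤j (does⇒ (+ 0 ℤ.<? _) 0<h+s)) U , V

Above⇒goC-unseen : ∀ {h s u v} → Above (+ 1) h (s ∷ u) (+ 1) → Above (+ 1) (+ 1) v (+ 0) →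
                   T (goC h false (s ∷ u ++ v))
Above⇒goC-unseen {v = t ∷ w} (one e) V rewrite e = Above⇒goC-seen V
Above⇒goC-unseen {h} {s} (cons l U) V with h ℤ.+ val s ℤ.≟ + 1
... | yes _ = ∧-intro (⇒does (+ 0 ℤ.<? h ℤ.+ val s) (ℤ.suc[i]≤j⇒i<j l)) (Above⇒goC-seen (Above-++ U ℤ.≤-refl V))
... | no  _ = ∧-intro (⇒does (+ 0 ℤ.<? h ℤ.+ val s) (ℤ.suc[i]≤j⇒i<j l)) (Above⇒goC-unseen U V)

isC-split : ∀ p → T (isC p) → CSplit (+ 0) p
isC-split = goC-unseen⇒split

isC-join : ∀ {u v} → Above (+ 1) (+ 0) u (+ 1) → Above (+ 1) (+ 1) v (+ 0) → T (isC (u ++ v))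
isC-join U@(one _)    V = Above⇒goC-unseen U V
isC-join U@(cons _ _) V = Above⇒goC-unseen U V

isC-rev : ∀ {c} → T (isC c) → T (isC (rev c))
isC-rev {c} C with isC-split c C
... | u , v , refl , U , V = subst (T ∘ isC) (sym (rev-++ u v)) (isC-join (Above-rev V) (Above-rev U))

isC-from-B : ∀ {b v} → BWalk b → Above (+ 1) (+ 1) v (+ 0) → T (isC (b ++ v))
isC-from-B B V = isC-join (Above-weaken 1≤2 B) V

Decomposed : Walk → Set
Decomposed q = ∃₂ λ x y → PhiRel q x y × All (T ∘ isC) x × All (T ∘ isC) y

Φ-ii : ∀ {b₁ c a b₂} → BWalk b₁ → T (isC c) → AWalk a → BWalk b₂ → Decomposed (b₁ ++ c ++ a ++ rev b₂)
Φ-ii {b₁} {c} {a} {b₂} B₁ C A B₂ =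
  just (rev c) , just (b₁ ++ a ++ rev b₂) ,
  case-ii b₁ c a b₂ (isB-from-Above B₁) C (goA-from-Above A) (isB-from-Above B₂) ,
  just (isC-rev {c} C) ,
  just (isC-from-B B₁ (Above-++ (Above-shift (+ 1) A) ℤ.≤-refl (Above-weaken 1≤2 (Above-rev B₂))))

Φ-iii : ∀ {b₁ b₂ a} → BWalk b₁ → BWalk b₂ → AWalk a → Decomposed (b₁ ++ b₂ ++ a ++ [ m2 ])
Φ-iii {b₁} {b₂} {a} B₁ B₂ A =
  nothing , just (b₁ ++ rev a ++ rev b₂) ,
  case-iii b₁ b₂ a (isB-from-Above B₁) (isB-from-Above B₂) (goA-from-Above A) ,
  nothing ,
  just (isC-from-B B₁ (Above-++ (Above-shift (+ 1) (Above-rev A)) ℤ.≤-refl (Above-weaken 1≤2 (Above-rev B₂))))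

Φ-iv1 : ∀ {a b} → AWalk a → BWalk b → Decomposed (p2 ∷ a ++ rev b ++ [ m1 ])
Φ-iv1 {a} {b} A B =
  just (b ++ rev a ++ [ m1 ]) , nothing ,
  case-iv1 a b (goA-from-Above A) (isB-from-Above B) ,
  just (isC-from-B B (Above-++ (Above-shift (+ 1) (Above-rev A)) ℤ.≤-refl (one refl))) ,
  nothing

Φ-iv2 : ∀ {b₁ a₁ a₂ b₂} → BWalk b₁ → AWalk a₁ → AWalk a₂ → BWalk b₂ →
        Decomposed (b₁ ++ (p2 ∷ a₁ ++ (m2 ∷ a₂ ++ rev b₂)))
Φ-iv2 {b₁} {a₁} {a₂} {b₂} B₁ A₁ A₂ B₂ =
  just (b₁ ++ a₁ ++ b₂ ++ rev a₂ ++ [ m2 ]) , nothing ,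
  case-iv2 b₁ a₁ a₂ b₂ (isB-from-Above B₁) (goA-from-Above A₁) (goA-from-Above A₂) (isB-from-Above B₂) ,
  just (isC-from-B B₁
    (Above-++ (Above-shift (+ 1) A₁) ℤ.≤-refl
      (Above-++ (Above-weaken 1≤3 (Above-shift (+ 1) B₂)) 1≤2
        (Above-++ (Above-weaken 1≤2 (Above-shift (+ 2) (Above-rev A₂))) 1≤2 (one refl))))) ,
  nothing

split-B-A : ∀ {z} → Above (+ 2) (+ 1) z (+ 2) → ∃₂ λ x y → z ≡ x ++ y × BWalk x × AWalk y
split-B-A Z with first-visit Z
... | inj₂ X                     = _ , [] , sym (List.++-identityʳ _) , Above-shift (- + 1) X , nil
... | inj₁ (s , u , y , e , X , Y) = s ∷ u , y , e , Above-shift (- + 1) X , Above-shift (- + 2) Y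

first-return : ∀ {s m} → AWalk (s ∷ m) →
               Σ[ s₀ ∈ Step ] ∃₂ λ c a → s ∷ m ≡ s₀ ∷ c ++ a × Above (+ 1) (+ 0) (s₀ ∷ c) (+ 0) × AWalk a
first-return {s} {m} M with first-visit M
... | inj₁ r = r
... | inj₂ C = s , m , [] , cong (s ∷_) (sym (List.++-identityʳ m)) , C , nil

val≢0 : ∀ s → val s ≢ + 0
val≢0 m2 ()
val≢0 m1 ()
val≢0 p1 ()
val≢0 p2 ()

-- A C-walk is cut as b₁ m (rev b₂) at its first and last visits to 1. If m is empty, the first
-- steps of b₁ and b₂ select case (i), (iii) or (iv.1). Otherwise m, lowered by 1, is an A-walk;
-- cut at its first return to 0 it is an excursion followed by an A-walk, and the excursion is a
-- C-walk (case (ii)) unless it avoids height 1, in which case it reads +2 a₁ −2 (case (iv.2)).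
decompose-ends : ∀ {b₁ b₂} → BWalk b₁ → BWalk b₂ → Decomposed (b₁ ++ rev b₂)
decompose-ends {b₁} {b₂} B₁ B₂ with B-shape B₁ | B-shape B₂
... | inj₁ refl | inj₁ refl = nothing , nothing , case-i , nothing , nothing
... | _ | inj₂ (w₂ , refl , W₂) with split-B-A (Above-rev W₂)
...   | x , y , e , X , Y = subst Decomposed (cong (b₁ ++_) eq) (Φ-iii B₁ X Y)
  where
  eq : x ++ y ++ [ m2 ] ≡ rev (p2 ∷ w₂)
  eq = begin
    x ++ y ++ [ m2 ]   ≡⟨ List.++-assoc x y [ m2 ] ⟨
    (x ++ y) ++ [ m2 ] ≡⟨ cong (_++ [ m2 ]) e ⟨
    rev w₂ ++ [ m2 ]   ≡⟨ rev-∷ p2 w₂ ⟨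
    rev (p2 ∷ w₂)      ∎
decompose-ends {b₂ = b₂} B₁ B₂ | inj₂ (w₁ , refl , W₁) | inj₁ refl with split-B-A (Above-rev W₁)
... | x , y , e , X , Y = subst Decomposed (cong (p2 ∷_) eq) (Φ-iv1 (Above-rev Y) X)
  where
  eq : rev y ++ rev x ++ [ m1 ] ≡ w₁ ++ [ m1 ]
  eq = trans (sym (List.++-assoc (rev y) (rev x) [ m1 ])) (cong (_++ [ m1 ]) (sym (rev-split x y e)))

decompose-middle : ∀ {b₁ m b₂} → BWalk b₁ → Above (+ 1) (+ 1) m (+ 1) → BWalk b₂ → Decomposed (b₁ ++ m ++ rev b₂)
decompose-middle B₁ nil B₂ = decompose-ends B₁ B₂
decompose-middle {b₁} {s ∷ m} {b₂} B₁ M B₂ with first-return (Above-shift (- + 1) M)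
... | s₀ , c , a , refl , C , A with first-visit C
...   | inj₁ (_ , u , v , e , U , V) =
  subst Decomposed (cong (b₁ ++_) (sym (List.++-assoc (s₀ ∷ c) a (rev b₂))))
        (Φ-ii {c = s₀ ∷ c} B₁ (subst (T ∘ isC) (sym e) (isC-join (Above-weaken 1≤2 U) V)) A B₂)
...   | inj₂ D with leave-0-above-2 D
...     | inj₁ (_ , val≡0) = ⊥-elim (val≢0 s₀ val≡0)
...     | inj₂ (refl , D′) with ends-with-m2 D′
...       | x , refl , X = subst Decomposed (cong (λ w → b₁ ++ p2 ∷ w) eq) (Φ-iv2 B₁ (Above-shift (- + 2) X) A B₂)
  where
  eq : x ++ m2 ∷ a ++ rev b₂ ≡ ((x ++ [ m2 ]) ++ a) ++ rev b₂
  eq = sym (trans (List.++-assoc (x ++ [ m2 ]) a (rev b₂)) (List.++-assoc x [ m2 ] (a ++ rev b₂)))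

decompose-after-b₁ : ∀ {b₁ r} → BWalk b₁ → Above (+ 1) (+ 1) r (+ 0) → Decomposed (b₁ ++ r)
decompose-after-b₁ {b₁} {r} B₁ R with first-visit (Above-rev R)
... | inj₂ B₂ =
  subst (λ r → Decomposed (b₁ ++ r)) (rev-involutive r) (decompose-middle B₁ nil B₂)
... | inj₁ (s , u , v , e , B₂ , M) =
  subst (λ r → Decomposed (b₁ ++ r)) (sym (rev-split (s ∷ u) v e)) (decompose-middle B₁ (Above-rev M) B₂)

decompose : ∀ p → T (isC p) → Decomposed p
decompose p C with isC-split p C
... | u , r , refl , U , R with first-visit U
...   | inj₂ B₁ = decompose-after-b₁ B₁ R
...   | inj₁ (s , u₁ , u₂ , refl , B₁ , U₂) =
  subst Decomposed (sym (List.++-assoc (s ∷ u₁) u₂ r)) (decompose-after-b₁ B₁ (Above-++ U₂ ℤ.≤-refl R))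

isC-nonempty : ∀ {c} → T (isC c) → 0 ℕ.< length c
isC-nonempty {_ ∷ _} _ = ℕ.s≤s ℕ.z≤n

children-shorter : ∀ {x y} → All (T ∘ isC) x → All (T ∘ isC) y →
                   All (λ w → length w ℕ.< size x + size y) x × All (λ w → length w ℕ.< size x + size y) y
children-shorter nothing          nothing           = nothing , nothing
children-shorter nothing          (just _)          = nothing , just (ℕ.m<n+m _ (ℕ.s≤s ℕ.z≤n))
children-shorter (just _)         nothing           = just (ℕ.m<m+n _ (ℕ.s≤s ℕ.z≤n)) , nothing
children-shorter (just {c₁} C₁) (just {c₂} C₂) =
  just (ℕ.m<m+n _ (isC-nonempty {c₂} C₂)) , just (ℕ.m<n+m _ (isC-nonempty {c₁} C₁))

Φ-shrinks : ∀ {q x y} → PhiRel q x y → All (T ∘ isC) x → All (T ∘ isC) y →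
            All (λ w → length w ℕ.< length q) x × All (λ w → length w ℕ.< length q) y
Φ-shrinks φ Cx Cy rewrite length-Φ φ = children-shorter Cx Cy

child-tree : ∀ {n x} → All (T ∘ isC) x → All (λ w → length w ℕ.< n) x →
             (∀ {q} → length q ℕ.< n → T (isC q) → ∃ (TreeOf q)) → ∃ (ChildOf x)
child-tree nothing  nothing   _       = leaf , eps
child-tree (just C) (just q<n) subtree = let t , Tq = subtree q<n C in t , walk Tq

tree-acc : ∀ q → Acc ℕ._<_ (length q) → T (isC q) → ∃ (TreeOf q)
tree-acc q (acc rs) C =
  let x , y , φ , Cx , Cy = decompose q C
      x< , y<             = Φ-shrinks φ Cx Cy
      l , L               = child-tree Cx x< subtree
      r , R               = child-tree Cy y< subtree
  in  node l r , mk φ L R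
  where
  subtree : ∀ {q′} → length q′ ℕ.< length q → T (isC q′) → ∃ (TreeOf q′)
  subtree q′<q = tree-acc _ (rs q′<q)

tree-exists : ∀ p → T (isC p) → ∃ (TreeOf p)
tree-exists p = tree-acc p (<-wellFounded (length p))

countSteps≡leaves : ∀ k {p t} → TreeOf p t → countSteps (ofKind k) (+ 0) p ≡ leaves k t
countSteps≡leaves k {p} Tp = trans (countSteps≡count k (+ 0) p) (count≡leaves Tp k)

proposition5 : ∀ (p : Walk) → T (isC p) →
    (∃ λ t → TreeOf p t) ×
    (∀ t → TreeOf p t →
      (countSteps pm1 (+ 0) p ≡ doubleLeaves t) ×
      (countSteps oddP2-evenM2 (+ 0) p ≡ leftLeaves t) ×
      (countSteps oddM2-evenP2 (+ 0) p ≡ rightLeaves t))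
proposition5 p C =
  tree-exists p C ,
  λ t Tp → countSteps≡leaves double Tp , countSteps≡leaves left Tp , countSteps≡leaves right Tp
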